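{- Let $p\geq 1$ be an integer and let $(a_n^{(k)})_{n\in\mathbb{Z}}$, $0\leq k\leq p$, be bi-infinite sequences of complex numbers. With the lattice paths, weights and formal power series defined in the context, the following identities hold in $\mathbb{C}((z^{ -1}))$: \[ W_{0}(z)=\frac{1}{z-a_{0}^{(0)}-\sum_{j=1}^{p}\sum_{k=0}^{j}a_{ -k}^{(j)}\,A_{j-k-1}^{(1)}(z)\,B_{k-1}^{(1)}(z)}, \] where $A_{ -1}^{(1)}(z)\equiv B_{ -1}^{(1)}(z)\equiv 1$; \[ W_{j}(z)=W_{0}(z)\,A_{j-1}^{(1)}(z)\quad (1\leq j\leq p); \] and more generally \[ W_{j}(z)=W_{i}(z)\,A_{j-i-1}^{(i+1)}(z)\quad (0\leq i<j\leq p). \]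
   Context: $\mathbb{C}((z^{ -1}))$ denotes the field of formal series $\sum_{n\in\mathbb{Z}} c_n z^{ -n}$ with complex coefficients and only finitely many nonzero $c_n$ with $n<0$. Lattice paths have vertices in $\mathbb{Z}_{\geq 0}\times\mathbb{Z}$ and are finite sequences of steps, consecutive steps sharing endpoints; the allowed steps are upsteps $(n,m)\to(n+1,m+1)$, level steps $(n,m)\to(n+1,m)$, and downsteps $(n,m)\to(n+1,m-j)$ with $1\leq j\leq p$. The length of a path is its number of steps (a path of length $0$ is a single vertex). Weights: every upstep has weight $1$; a step $(n,m)\to(n+1,m-j)$ with $0\leq j\leq p$ has weight $a_{m-j}^{(j)}$. The weight $w(\gamma)$ of a path is the product of the weights of its steps ($1$ for a path of length $0$). For an integer $q$, $\gamma+q$ denotes the path shifted vertically by $q$ units ($q>0$ upward, $q<0$ downward). $\min(\gamma)$ and $\max(\gamma)$ are the minimal and maximal heights of the vertices of $\gamma$. For $n\geq 0$ and $0\leq j\leq p$: $\mathcal{P}_{[n,j]}$ is the set of all paths of length $n$ from $(0,0)$ to $(n,j)$; $\mathcal{D}_{[n,j]}$ is the set of paths in $\mathcal{P}_{[n,j]}$ with $\min(\gamma)=0$; $\widehat{\mathcal{D}}_{[n,j]}$ is the set of paths of length $n$ from $(0,-j)$ to $(n,0)$ with $\max(\gamma)=0$. Put (empty sums being $0$) $W_{[n,j]}=\sum_{\gamma\in\mathcal{P}_{[n,j]}}w(\gamma)$, and for integers $q\geq0$, $A_{[n,j]}^{(q)}=\sum_{\gamma\in\mathcal{D}_{[n,j]}}w(\gamma+q)$,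 $B_{[n,j]}^{(q)}=\sum_{\gamma\in\widehat{\mathcal{D}}_{[n,j]}}w(\gamma-q)$. Define formal series $W_j(z)=\sum_{n\ge0}W_{[n,j]}z^{ -n-1}$, $A_j^{(q)}(z)=\sum_{n\ge0}A^{(q)}_{[n,j]}z^{ -n-1}$, $B_j^{(q)}(z)=\sum_{n\ge0}B^{(q)}_{[n,j]}z^{ -n-1}$. -}

module Defs where

open import Level using (Level)
open import Algebra.Bundles using (CommutativeRing)
open import Data.Nat as ℕ using (ℕ; zero; suc; _<ᵇ_; _∸_)
open import Data.Integer as ℤ using (ℤ; +_; -[1+_])
open import Data.Fin using (Fin; toℕ)
open import Data.List using (List; []; _∷_; map; foldr; concatMap; upTo)
open import Data.List.Base using (allFin)
open import Data.Bool using (Bool; if_then_else_; _∧_)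
open import Relation.Nullary.Decidable using (⌊_⌋)

-- Lattice paths: a path is a starting height together with a list of steps.
-- 'up' is an upstep; 'dn j' (j : Fin (suc p)) is the step (n,m) → (n+1,m-j);
-- 'dn 0' is the level step.
data Step (p : ℕ) : Set where
  up : Step p
  dn : Fin (suc p) → Step p

δ : ∀ {p} → Step p → ℤ
δ up     = + 1
δ (dn j) = ℤ.- (+ toℕ j)

allSteps : (p : ℕ) → List (Step p)
allSteps p = up ∷ map dn (allFin (suc p))

-- all step sequences of length n (pairwise distinct, so summing over this
-- list = summing over the set of paths of length n with a given start)
seqs : (p : ℕ) → ℕ → List (List (Step p))
seqs p zero    = [] ∷ []
seqs p (suc n) = concatMap (λ s → map (s ∷_) (seqs p n)) (allSteps p)

endH : ∀ {p} → ℤ → List (Step p) → ℤ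
endH h []       = h
endH h (s ∷ ss) = endH (h ℤ.+ δ s) ss

minH : ∀ {p} → ℤ → List (Step p) → ℤ
minH h []       = h
minH h (s ∷ ss) = h ℤ.⊓ minH (h ℤ.+ δ s) ss

maxH : ∀ {p} → ℤ → List (Step p) → ℤ
maxH h []       = h
maxH h (s ∷ ss) = h ℤ.⊔ maxH (h ℤ.+ δ s) ss

infix 4 _==_
_==_ : ℤ → ℤ → Bool
x == y = ⌊ x ℤ.≟ y ⌋

module Setup {c ℓ : Level} (R : CommutativeRing c ℓ) where
  open CommutativeRing R

  sumR : List Carrier → Carrier
  sumR = foldr _+_ 0#

  -- weight of a path starting at height h; a j m = a_m^{(j)}.
  -- upstep: weight 1; step (m) → (m - j): weight a_{m-j}^{(j)}.
  weight : ∀ {p} → (Fin (suc p) → ℤ → Carrier) → ℤ → List (Step p) → Carrier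
  weight a h []            = 1#
  weight a h (up ∷ ss)     = 1# * weight a (h ℤ.+ + 1) ss
  weight a h (dn j ∷ ss)   = a j (h ℤ.- + toℕ j) * weight a (h ℤ.- + toℕ j) ss

  Wc : (p : ℕ) → (Fin (suc p) → ℤ → Carrier) → ℕ → ℕ → Carrier
  Wc p a n j = sumR (map (λ ss → if (endH (+ 0) ss == (+ j)) then weight a (+ 0) ss else 0#) (seqs p n))

  -- A^{(q)}_[n,j] : paths (0,0) → (n,j) with min = 0, weighted after shifting up by q
  Ac : (p : ℕ) → (Fin (suc p) → ℤ → Carrier) → ℕ → ℕ → ℕ → Carrier
  Ac p a q n j = sumR (map (λ ss →
    if (endH (+ 0) ss == (+ j)) ∧ (minH (+ 0) ss == (+ 0))
    then weight a (+ q) ss else 0#) (seqs p n))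

  -- B^{(q)}_[n,j] : paths (0,-j) → (n,0) with max = 0, weighted after shifting down by q
  Bc : (p : ℕ) → (Fin (suc p) → ℤ → Carrier) → ℕ → ℕ → ℕ → Carrier
  Bc p a q n j = sumR (map (λ ss →
    if (endH (ℤ.- + j) ss == (+ 0)) ∧ (maxH (ℤ.- + j) ss == (+ 0))
    then weight a ((ℤ.- + j) ℤ.- + q) ss else 0#) (seqs p n))

  -- Formal Laurent series in z^{-1}: ⟨ k , f ⟩ stands for Σ_{n≥0} f n · z^{k-n}.
  record Laurent : Set c where
    constructor ⟨_,_⟩
    field
      top : ℕ
      cf  : ℕ → Carrier

  coef : Laurent → ℤ → Carrier
  coef ⟨ k , f ⟩ e with (+ k) ℤ.- e
  ... | + n      = f n
  ... | -[1+ _ ] = 0#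

  infix 4 _≈L_
  _≈L_ : Laurent → Laurent → Set ℓ
  x ≈L y = ∀ e → coef x e ≈ coef y e

  shiftCf : ℕ → (ℕ → Carrier) → ℕ → Carrier
  shiftCf m f n = if n <ᵇ m then 0# else f (n ∸ m)

  infixl 6 _+L_ _-L_
  infixl 7 _*L_
  _+L_ : Laurent → Laurent → Laurent
  ⟨ k , f ⟩ +L ⟨ l , g ⟩ = ⟨ k ℕ.+ l , (λ n → shiftCf l f n + shiftCf k g n) ⟩

  -L_ : Laurent → Laurent
  -L ⟨ k , f ⟩ = ⟨ k , (λ n → - f n) ⟩

  _-L_ : Laurent → Laurent → Laurent
  x -L y = x +L (-L y)

  _*L_ : Laurent → Laurent → Laurent
  ⟨ k , f ⟩ *L ⟨ l , g ⟩ =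
    ⟨ k ℕ.+ l , (λ n → sumR (map (λ i → f i * g (n ∸ i)) (upTo (suc n)))) ⟩

  constL : Carrier → Laurent
  constL x = ⟨ 0 , (λ { zero → x ; (suc _) → 0# }) ⟩

  0L 1L zL : Laurent
  0L = constL 0#
  1L = constL 1#
  zL = ⟨ 1 , (λ { zero → 1# ; (suc _) → 0# }) ⟩

  sumL : List Laurent → Laurent
  sumL = foldr _+L_ 0L

  -- Σ_{n≥0} g n z^{-n-1}
  series : (ℕ → Carrier) → Laurent
  series g = ⟨ 0 , (λ { zero → 0# ; (suc n) → g n }) ⟩

  W : (p : ℕ) → (Fin (suc p) → ℤ → Carrier) → ℕ → Laurent
  W p a j = series (λ n → Wc p a n j)

  A : (p : ℕ) → (Fin (suc p) → ℤ → Carrier) → ℕ → ℕ → Laurent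
  A p a q j = series (λ n → Ac p a q n j)

  B : (p : ℕ) → (Fin (suc p) → ℤ → Carrier) → ℕ → ℕ → Laurent
  B p a q j = series (λ n → Bc p a q n j)

  -- Am1 p a q m = A^{(q)}_{m-1}(z), with A^{(q)}_{-1} ≡ 1 ; likewise Bm1
  Am1 : (p : ℕ) → (Fin (suc p) → ℤ → Carrier) → ℕ → ℕ → Laurent
  Am1 p a q zero    = 1L
  Am1 p a q (suc m) = A p a q m

  Bm1 : (p : ℕ) → (Fin (suc p) → ℤ → Carrier) → ℕ → ℕ → Laurent
  Bm1 p a q zero    = 1L
  Bm1 p a q (suc m) = B p a q m

  denom : (p : ℕ) → (Fin (suc p) → ℤ → Carrier) → Laurent
  denom p a =
    zL -L constL (a Fin.zero (+ 0))
       -L sumL (map (λ (i : Fin p) →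
              let j = Fin.suc i in
              sumL (map (λ k → constL (a j (ℤ.- + k)) *L Am1 p a 1 (toℕ j ∸ k) *L Bm1 p a 1 k)
                        (upTo (suc (toℕ j)))))
            (allFin p))
    where import Data.Fin as Fin

{-# OPTIONS --safe #-}
-- All identities are path decompositions, compared coefficientwise.  Since upsteps climb by
-- exactly one, a path from 0 to j > i is at height i at its last visit to heights ≤ i and stays
-- above i afterwards: W_j = W_i · A^{(i+1)}_{j-i-1}.  For W_0 decompose by the first step.  A
-- level step leaves a_0^{(0)} W_0.  After a downstep to -k, split at the first return to 0 (an
-- upstep from a path staying ≤ -1): this gives a_{-k}^{(k)} B^{(1)}_{k-1} W_0.  After an upstep,
-- split where the path first leaves the heights ≥ 1, by a jump of size j from j - k down to -k
-- (k < j): this gives a_{-k}^{(j)} A^{(1)}_{j-k-1} B^{(1)}_{k-1} W_0.  Hence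
-- z W_0 = 1 + (a_0^{(0)} + Σ …) W_0, which is the first identity.
module Submission where

open import Defs
open import Algebra.Bundles using (CommutativeRing)
open import Data.Nat using (ℕ; suc; _≤_; _<_; _∸_)
open import Data.Integer using (ℤ)
open import Data.Fin using (Fin)
open import Data.Product using (_×_)

import Algebra.Properties.AbelianGroup as AbelianGroupProperties
import Algebra.Properties.CommutativeSemigroup as CommutativeSemigroupProperties
import Algebra.Properties.Ring as RingProperties
open import Data.Bool using (Bool; true; false; if_then_else_; _∧_)
open import Data.Bool.Properties using (∧-zeroʳ; ∧-identityʳ)
open import Data.Fin as Fin using (toℕ)
import Data.Integer as ℤ
open import Data.Integer using (+_; -[1+_])
import Data.Integer.Properties as ℤP
open import Data.List using (List; []; _∷_; _++_; map; concatMap; upTo; applyUpTo)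
open import Data.List.Base using (allFin)
open import Data.List.Properties using (map-tabulate)
open import Data.Nat as ℕ using (zero; z≤n; s≤s)
import Data.Nat.Properties as ℕP
open import Data.Product using (_,_)
open import Function using (_∘_; id; _⇔_; mk⇔)
open import Relation.Binary.Definitions using (tri<; tri≈; tri>)
open import Relation.Binary.PropositionalEquality as ≡ using (_≡_; _≢_; cong)
open import Relation.Nullary using (¬_; Dec; yes; no)
open import Relation.Nullary.Decidable using (⌊_⌋; _×-dec_; isYes≗does; does-⇔; dec-true; dec-false)

module _ {ℓ₁ ℓ₂} {A : Set ℓ₁} {B : Set ℓ₂} where

  ⌊⌋-⇔ : A ⇔ B → (a? : Dec A) (b? : Dec B) → ⌊ a? ⌋ ≡ ⌊ b? ⌋
  ⌊⌋-⇔ A⇔B a? b? = ≡.trans (isYes≗does a?) (≡.trans (does-⇔ A⇔B a? b?) (≡.sym (isYes≗does b?)))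

  ⌊⌋-×-dec : (a? : Dec A) (b? : Dec B) → ⌊ a? ×-dec b? ⌋ ≡ ⌊ a? ⌋ ∧ ⌊ b? ⌋
  ⌊⌋-×-dec a? b? = ≡.trans (isYes≗does (a? ×-dec b?))
    (≡.cong₂ _∧_ (≡.sym (isYes≗does a?)) (≡.sym (isYes≗does b?)))

module _ {ℓ₁} {A : Set ℓ₁} where

  ⌊⌋-true : (a? : Dec A) → A → ⌊ a? ⌋ ≡ true
  ⌊⌋-true a? x = ≡.trans (isYes≗does a?) (dec-true a? x)

  ⌊⌋-false : (a? : Dec A) → ¬ A → ⌊ a? ⌋ ≡ false
  ⌊⌋-false a? ¬x = ≡.trans (isYes≗does a?) (dec-false a? ¬x)

module _ where
  open AbelianGroupProperties ℤP.+-0-abelianGroup using (∙-cancelʳ; //-rightDividesʳ)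

  ==-+ : ∀ r x y → (x == y) ≡ (x ℤ.+ r == y ℤ.+ r)
  ==-+ r x y = ⌊⌋-⇔ (mk⇔ (cong (ℤ._+ r)) (∙-cancelʳ r x y)) (x ℤ.≟ y) (x ℤ.+ r ℤ.≟ y ℤ.+ r)

  ≤ᵇ-+ : ∀ r x y → ⌊ x ℤ.≤? y ⌋ ≡ ⌊ x ℤ.+ r ℤ.≤? y ℤ.+ r ⌋
  ≤ᵇ-+ r x y = ⌊⌋-⇔ (mk⇔ (ℤP.+-monoˡ-≤ r) cancel) (x ℤ.≤? y) (x ℤ.+ r ℤ.≤? y ℤ.+ r)
    where
    cancel : x ℤ.+ r ℤ.≤ y ℤ.+ r → x ℤ.≤ y
    cancel le = ≡.subst₂ ℤ._≤_ (//-rightDividesʳ r x) (//-rightDividesʳ r y) (ℤP.+-monoˡ-≤ (ℤ.- r) le)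

≤ᵇ-⊓ : ∀ f x y → ⌊ f ℤ.≤? x ℤ.⊓ y ⌋ ≡ ⌊ f ℤ.≤? x ⌋ ∧ ⌊ f ℤ.≤? y ⌋
≤ᵇ-⊓ f x y = ≡.trans
  (⌊⌋-⇔ (mk⇔ (λ le → ℤP.≤-trans le (ℤP.i⊓j≤i x y) , ℤP.≤-trans le (ℤP.i⊓j≤j x y))
             (λ (l , r) → ℤP.⊓-glb l r))
        (f ℤ.≤? x ℤ.⊓ y) (f ℤ.≤? x ×-dec f ℤ.≤? y))
  (⌊⌋-×-dec (f ℤ.≤? x) (f ℤ.≤? y))

⊔-≤ᵇ : ∀ x y g → ⌊ x ℤ.⊔ y ℤ.≤? g ⌋ ≡ ⌊ x ℤ.≤? g ⌋ ∧ ⌊ y ℤ.≤? g ⌋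
⊔-≤ᵇ x y g = ≡.trans
  (⌊⌋-⇔ (mk⇔ (λ le → ℤP.≤-trans (ℤP.i≤i⊔j x y) le , ℤP.≤-trans (ℤP.i≤j⊔i x y) le)
             (λ (l , r) → ℤP.⊔-lub l r))
        (x ℤ.⊔ y ℤ.≤? g) (x ℤ.≤? g ×-dec y ℤ.≤? g))
  (⌊⌋-×-dec (x ℤ.≤? g) (y ℤ.≤? g))

==-as-≥ : ∀ {x l} → x ℤ.≤ l → (x == l) ≡ ⌊ l ℤ.≤? x ⌋
==-as-≥ {x} {l} x≤l = ⌊⌋-⇔ (mk⇔ (λ { ≡.refl → ℤP.≤-refl }) (ℤP.≤-antisym x≤l)) (x ℤ.≟ l) (l ℤ.≤? x)

==-as-≤ : ∀ {x l} → l ℤ.≤ x → (x == l) ≡ ⌊ x ℤ.≤? l ⌋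
==-as-≤ {x} {l} l≤x = ⌊⌋-⇔ (mk⇔ (λ { ≡.refl → ℤP.≤-refl }) (λ x≤l → ℤP.≤-antisym x≤l l≤x)) (x ℤ.≟ l) (x ℤ.≤? l)

==-∧-== : ∀ x y l → x ℤ.≤ y → ((x == l) ∧ (y == l)) ≡ ((x == l) ∧ ⌊ y ℤ.≤? l ⌋)
==-∧-== x y l x≤y with x ℤ.≟ l
... | yes ≡.refl = ==-as-≤ x≤y
... | no _       = ≡.refl

above-open : ∀ i {h} → + i ℤ.< h → ⌊ + suc i ℤ.≤? h ⌋ ≡ true
above-open i {+ _} (ℤ.+<+ i<h) = ⌊⌋-true (_ ℤ.≤? _) (ℤ.+≤+ i<h)

above-closed : ∀ i {h} → h ℤ.≤ + i → ⌊ + suc i ℤ.≤? h ⌋ ≡ false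
above-closed i {h} h≤i = ⌊⌋-false (_ ℤ.≤? h) (λ i<h → ℕP.n≮n i (ℤP.drop‿+≤+ (ℤP.≤-trans i<h h≤i)))

module _ {p : ℕ} where
  open CommutativeSemigroupProperties ℤP.+-commutativeSemigroup using (xy∙z≈xz∙y)

  endH-+ : ∀ r h (ss : List (Step p)) → endH (h ℤ.+ r) ss ≡ endH h ss ℤ.+ r
  endH-+ r h []       = ≡.refl
  endH-+ r h (s ∷ ss) = ≡.trans (cong (λ x → endH x ss) (xy∙z≈xz∙y h r (δ s))) (endH-+ r (h ℤ.+ δ s) ss)

  minH-+ : ∀ r h (ss : List (Step p)) → minH (h ℤ.+ r) ss ≡ minH h ss ℤ.+ r
  minH-+ r h []       = ≡.refl
  minH-+ r h (s ∷ ss) = begin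
    (h ℤ.+ r) ℤ.⊓ minH (h ℤ.+ r ℤ.+ δ s) ss   ≡⟨ cong (λ x → (h ℤ.+ r) ℤ.⊓ minH x ss) (xy∙z≈xz∙y h r (δ s)) ⟩
    (h ℤ.+ r) ℤ.⊓ minH (h ℤ.+ δ s ℤ.+ r) ss   ≡⟨ cong ((h ℤ.+ r) ℤ.⊓_) (minH-+ r (h ℤ.+ δ s) ss) ⟩
    (h ℤ.+ r) ℤ.⊓ (minH (h ℤ.+ δ s) ss ℤ.+ r) ≡⟨ ℤP.mono-<-distrib-⊓ (ℤ._+ r) (ℤP.+-monoˡ-< r) h _ ⟨
    (h ℤ.⊓ minH (h ℤ.+ δ s) ss) ℤ.+ r         ∎
    where open ≡.≡-Reasoning

  maxH-+ : ∀ r h (ss : List (Step p)) → maxH (h ℤ.+ r) ss ≡ maxH h ss ℤ.+ r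
  maxH-+ r h []       = ≡.refl
  maxH-+ r h (s ∷ ss) = begin
    (h ℤ.+ r) ℤ.⊔ maxH (h ℤ.+ r ℤ.+ δ s) ss   ≡⟨ cong (λ x → (h ℤ.+ r) ℤ.⊔ maxH x ss) (xy∙z≈xz∙y h r (δ s)) ⟩
    (h ℤ.+ r) ℤ.⊔ maxH (h ℤ.+ δ s ℤ.+ r) ss   ≡⟨ cong ((h ℤ.+ r) ℤ.⊔_) (maxH-+ r (h ℤ.+ δ s) ss) ⟩
    (h ℤ.+ r) ℤ.⊔ (maxH (h ℤ.+ δ s) ss ℤ.+ r) ≡⟨ ℤP.mono-<-distrib-⊔ (ℤ._+ r) (ℤP.+-monoˡ-< r) h _ ⟨
    (h ℤ.⊔ maxH (h ℤ.+ δ s) ss) ℤ.+ r         ∎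
    where open ≡.≡-Reasoning

  minH≤start : ∀ h (ss : List (Step p)) → minH h ss ℤ.≤ h
  minH≤start h []       = ℤP.≤-refl
  minH≤start h (s ∷ ss) = ℤP.i⊓j≤i h _

  endH≤maxH : ∀ h (ss : List (Step p)) → endH h ss ℤ.≤ maxH h ss
  endH≤maxH h []       = ℤP.≤-refl
  endH≤maxH h (s ∷ ss) = ℤP.≤-trans (endH≤maxH (h ℤ.+ δ s) ss) (ℤP.i≤j⊔i h _)

module Sums {c ℓ} (R : CommutativeRing c ℓ) where
  open CommutativeRing R
  open Setup R using (sumR)
  open import Relation.Binary.Reasoning.Setoid setoid

  ∑ : {A : Set} → List A → (A → Carrier) → Carrier
  ∑ l F = sumR (map F l)

  syntax ∑ l (λ x → e) = ∑[ x ∈ l ] e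

  module _ {A : Set} where

    ∑-cong : ∀ l {F G : A → Carrier} → (∀ x → F x ≈ G x) → ∑ l F ≈ ∑ l G
    ∑-cong []      F≈G = refl
    ∑-cong (x ∷ l) F≈G = +-cong (F≈G x) (∑-cong l F≈G)

    ∑-distrib-+ : ∀ l (F G : A → Carrier) → ∑[ x ∈ l ] (F x + G x) ≈ ∑ l F + ∑ l G
    ∑-distrib-+ []      F G = sym (+-identityˡ 0#)
    ∑-distrib-+ (x ∷ l) F G = trans (+-cong refl (∑-distrib-+ l F G)) (interchange _ _ _ _)
      where open CommutativeSemigroupProperties +-commutativeSemigroup using (interchange)

    *-distribˡ-∑ : ∀ l y (F : A → Carrier) → y * ∑ l F ≈ ∑[ x ∈ l ] (y * F x)
    *-distribˡ-∑ []      y F = zeroʳ y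
    *-distribˡ-∑ (x ∷ l) y F = trans (distribˡ y _ _) (+-cong refl (*-distribˡ-∑ l y F))

    ∑-zero : ∀ l {F : A → Carrier} → (∀ x → F x ≈ 0#) → ∑ l F ≈ 0#
    ∑-zero []      F≈0 = refl
    ∑-zero (x ∷ l) F≈0 = trans (+-cong (F≈0 x) (∑-zero l F≈0)) (+-identityˡ 0#)

    ∑-++ : ∀ l l′ (F : A → Carrier) → ∑ (l ++ l′) F ≈ ∑ l F + ∑ l′ F
    ∑-++ []      l′ F = sym (+-identityˡ _)
    ∑-++ (x ∷ l) l′ F = trans (+-cong refl (∑-++ l l′ F)) (sym (+-assoc _ _ _))

  ∑-map : ∀ {A B : Set} (l : List A) (g : A → B) (F : B → Carrier) → ∑ (map g l) F ≡ ∑ l (F ∘ g)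
  ∑-map []      g F = ≡.refl
  ∑-map (x ∷ l) g F = cong (λ s → F (g x) + s) (∑-map l g F)

  ∑-concatMap : ∀ {A B : Set} (l : List A) (g : A → List B) (F : B → Carrier) →
                ∑ (concatMap g l) F ≈ ∑[ x ∈ l ] ∑ (g x) F
  ∑-concatMap []      g F = refl
  ∑-concatMap (x ∷ l) g F = trans (∑-++ (g x) (concatMap g l) F) (+-cong refl (∑-concatMap l g F))

  ∑-allFin-suc : ∀ n (F : Fin (suc n) → Carrier) → ∑ (allFin (suc n)) F ≡ F Fin.zero + ∑ (allFin n) (F ∘ Fin.suc)
  ∑-allFin-suc n F = cong (λ s → F Fin.zero + sumR s)
    (≡.trans (map-tabulate Fin.suc F) (≡.sym (map-tabulate id (F ∘ Fin.suc))))

  ∑< : ℕ → (ℕ → Carrier) → Carrier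
  ∑< zero    F = 0#
  ∑< (suc m) F = F 0 + ∑< m (F ∘ suc)

  ∑-applyUpTo : ∀ {A : Set} (F : A → Carrier) (g : ℕ → A) m → ∑ (applyUpTo g m) F ≡ ∑< m (F ∘ g)
  ∑-applyUpTo F g zero    = ≡.refl
  ∑-applyUpTo F g (suc m) = cong (λ s → F (g 0) + s) (∑-applyUpTo F (g ∘ suc) m)

  ∑-upTo : ∀ m (F : ℕ → Carrier) → ∑ (upTo m) F ≡ ∑< m F
  ∑-upTo m F = ∑-applyUpTo F id m

  ∑<-cong : ∀ m {F G : ℕ → Carrier} → (∀ k → k < m → F k ≈ G k) → ∑< m F ≈ ∑< m G
  ∑<-cong zero    F≈G = refl
  ∑<-cong (suc m) F≈G = +-cong (F≈G 0 (s≤s z≤n)) (∑<-cong m (λ k k<m → F≈G (suc k) (s≤s k<m)))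

  ∑<-suc : ∀ m F → ∑< (suc m) F ≈ ∑< m F + F m
  ∑<-suc zero    F = trans (+-identityʳ _) (sym (+-identityˡ _))
  ∑<-suc (suc m) F = trans (+-cong refl (∑<-suc m (F ∘ suc))) (sym (+-assoc _ _ _))

  ∑-upTo-suc : ∀ m F → ∑ (upTo (suc m)) F ≈ ∑ (upTo m) F + F m
  ∑-upTo-suc m F = trans (reflexive (∑-upTo (suc m) F)) (trans (∑<-suc m F) (+-cong (reflexive (≡.sym (∑-upTo m F))) refl))

  if-cong : ∀ {b b′ x y} → b ≡ b′ → x ≈ y → (if b then x else 0#) ≈ (if b′ then y else 0#)
  if-cong {true}  ≡.refl x≈y = x≈y
  if-cong {false} ≡.refl x≈y = refl

  *-if : ∀ (b : Bool) x y → x * (if b then y else 0#) ≈ (if b then x * y else 0#)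
  *-if true  x y = refl
  *-if false x y = zeroʳ x

  ∑<-select : ∀ n m (X : ℕ → Carrier) →
    ∑< m (λ k → if (+ suc n == + (m ∸ k)) then X k else 0#) ≈ (if ⌊ suc n ℕ.≤? m ⌋ then X (m ∸ suc n) else 0#)
  ∑<-select n zero    X = refl
  ∑<-select n (suc m) X with ℕP.<-cmp n m
  ... | tri< n<m _ _ = begin
    (if (+ suc n == + suc m) then X 0 else 0#) + ∑< m (λ k → if (+ suc n == + (m ∸ k)) then X (suc k) else 0#)
      ≈⟨ +-cong (if-cong (⌊⌋-false (_ ℤ.≟ _) (λ eq → ℕP.<⇒≢ n<m (ℕP.suc-injective (ℤP.+-injective eq)))) refl) (∑<-select n m (X ∘ suc)) ⟩
    0# + (if ⌊ suc n ℕ.≤? m ⌋ then X (suc (m ∸ suc n)) else 0#)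
      ≈⟨ +-identityˡ _ ⟩
    (if ⌊ suc n ℕ.≤? m ⌋ then X (suc (m ∸ suc n)) else 0#)
      ≈⟨ if-cong (≡.trans (⌊⌋-true (_ ℕ.≤? _) n<m) (≡.sym (⌊⌋-true (_ ℕ.≤? _) (ℕP.m≤n⇒m≤1+n n<m))))
                 (reflexive (cong X (≡.sym (ℕP.+-∸-assoc 1 n<m)))) ⟩
    (if ⌊ suc n ℕ.≤? suc m ⌋ then X (m ∸ n) else 0#) ∎
  ... | tri≈ _ ≡.refl _ = begin
    (if (+ suc n == + suc n) then X 0 else 0#) + ∑< n (λ k → if (+ suc n == + (n ∸ k)) then X (suc k) else 0#)
      ≈⟨ +-cong (if-cong (⌊⌋-true (_ ℤ.≟ _) ≡.refl) refl) (∑<-select n n (X ∘ suc)) ⟩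
    X 0 + (if ⌊ suc n ℕ.≤? n ⌋ then X (suc (n ∸ suc n)) else 0#)
      ≈⟨ +-cong refl (if-cong (⌊⌋-false (_ ℕ.≤? _) (ℕP.n≮n n)) refl) ⟩
    X 0 + 0#
      ≈⟨ +-identityʳ _ ⟩
    X 0
      ≈⟨ if-cong (⌊⌋-true (_ ℕ.≤? _) ℕP.≤-refl) (reflexive (cong X (ℕP.n∸n≡0 n))) ⟨
    (if ⌊ suc n ℕ.≤? suc n ⌋ then X (n ∸ n) else 0#) ∎
  ... | tri> _ _ m<n = begin
    (if (+ suc n == + suc m) then X 0 else 0#) + ∑< m (λ k → if (+ suc n == + (m ∸ k)) then X (suc k) else 0#)
      ≈⟨ +-cong (if-cong (⌊⌋-false (_ ℤ.≟ _) (λ eq → ℕP.>⇒≢ m<n (ℕP.suc-injective (ℤP.+-injective eq)))) refl) (∑<-select n m (X ∘ suc)) ⟩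
    0# + (if ⌊ suc n ℕ.≤? m ⌋ then X (suc (m ∸ suc n)) else 0#)
      ≈⟨ +-identityˡ _ ⟩
    (if ⌊ suc n ℕ.≤? m ⌋ then X (suc (m ∸ suc n)) else 0#)
      ≈⟨ trans (if-cong (⌊⌋-false (_ ℕ.≤? _) (ℕP.<⇒≱ (ℕP.m<n⇒m<1+n m<n))) refl)
               (sym (if-cong (⌊⌋-false (_ ℕ.≤? _) (ℕP.<⇒≱ (s≤s m<n))) refl)) ⟩
    (if ⌊ suc n ℕ.≤? suc m ⌋ then X (m ∸ n) else 0#) ∎

module CauchyProduct {c ℓ} (R : CommutativeRing c ℓ) where
  open CommutativeRing R
  open Sums R
  open import Relation.Binary.Reasoning.Setoid setoid

  Seq : Set c
  Seq = ℕ → Carrier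

  infixl 7 _⋆_
  _⋆_ : Seq → Seq → Seq
  (f ⋆ g) zero    = f 0 * g 0
  (f ⋆ g) (suc n) = f 0 * g (suc n) + ((f ∘ suc) ⋆ g) n

  shift : Seq → Seq
  shift f zero    = 0#
  shift f (suc n) = f n

  δ₀ : Seq
  δ₀ zero    = 1#
  δ₀ (suc n) = 0#

  ∑-upTo-≈-⋆ : ∀ f g n → ∑[ i ∈ upTo (suc n) ] (f i * g (n ∸ i)) ≈ (f ⋆ g) n
  ∑-upTo-≈-⋆ f g n = ≡.subst (_≈ (f ⋆ g) n) (≡.sym (∑-upTo (suc n) _)) (go f n)
    where
    go : ∀ f n → ∑< (suc n) (λ i → f i * g (n ∸ i)) ≈ (f ⋆ g) n
    go f zero    = +-identityʳ _
    go f (suc n) = +-cong refl (go (f ∘ suc) n)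

  ⋆-cong : ∀ {f f′ g g′} → (∀ n → f n ≈ f′ n) → (∀ n → g n ≈ g′ n) → ∀ n → (f ⋆ g) n ≈ (f′ ⋆ g′) n
  ⋆-cong f≈ g≈ zero    = *-cong (f≈ 0) (g≈ 0)
  ⋆-cong f≈ g≈ (suc n) = +-cong (*-cong (f≈ 0) (g≈ (suc n))) (⋆-cong (f≈ ∘ suc) g≈ n)

  ⋆-distribʳ-+ : ∀ f f′ g n → ((λ t → f t + f′ t) ⋆ g) n ≈ (f ⋆ g) n + (f′ ⋆ g) n
  ⋆-distribʳ-+ f f′ g zero    = distribʳ _ _ _
  ⋆-distribʳ-+ f f′ g (suc n) =
    trans (+-cong (distribʳ _ _ _) (⋆-distribʳ-+ (f ∘ suc) (f′ ∘ suc) g n)) (interchange _ _ _ _)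
    where open CommutativeSemigroupProperties +-commutativeSemigroup using (interchange)

  ⋆-*ˡ : ∀ x f g n → ((λ t → x * f t) ⋆ g) n ≈ x * (f ⋆ g) n
  ⋆-*ˡ x f g zero    = *-assoc _ _ _
  ⋆-*ˡ x f g (suc n) = trans (+-cong (*-assoc _ _ _) (⋆-*ˡ x (f ∘ suc) g n)) (sym (distribˡ _ _ _))

  ⋆-negˡ : ∀ f g n → ((λ t → - f t) ⋆ g) n ≈ - (f ⋆ g) n
  ⋆-negˡ f g zero    = sym (-‿distribˡ-* _ _)
    where open RingProperties ring using (-‿distribˡ-*)
  ⋆-negˡ f g (suc n) = trans (+-cong (sym (-‿distribˡ-* _ _)) (⋆-negˡ (f ∘ suc) g n)) (⁻¹-∙-comm _ _)
    where open RingProperties ring using (-‿distribˡ-*)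
          open AbelianGroupProperties +-abelianGroup using (⁻¹-∙-comm)

  ⋆-zeroˡ : ∀ f g → (∀ t → f t ≈ 0#) → ∀ n → (f ⋆ g) n ≈ 0#
  ⋆-zeroˡ f g f≈0 zero    = trans (*-cong (f≈0 0) refl) (zeroˡ _)
  ⋆-zeroˡ f g f≈0 (suc n) =
    trans (+-cong (trans (*-cong (f≈0 0) refl) (zeroˡ _)) (⋆-zeroˡ (f ∘ suc) g (f≈0 ∘ suc) n)) (+-identityˡ _)

  ⋆-identityˡ : ∀ g n → (δ₀ ⋆ g) n ≈ g n
  ⋆-identityˡ g zero    = *-identityˡ _
  ⋆-identityˡ g (suc n) = trans (+-cong (*-identityˡ _) (⋆-zeroˡ _ g (λ _ → refl) n)) (+-identityʳ _)

  ⋆-∑ˡ : ∀ {A : Set} (l : List A) (F : A → Seq) g n →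
         ((λ t → ∑[ x ∈ l ] F x t) ⋆ g) n ≈ ∑[ x ∈ l ] (F x ⋆ g) n
  ⋆-∑ˡ []      F g n = ⋆-zeroˡ _ g (λ _ → refl) n
  ⋆-∑ˡ (x ∷ l) F g n = trans (⋆-distribʳ-+ (F x) _ g n) (+-cong refl (⋆-∑ˡ l F g n))

  ⋆-comm : ∀ f g n → (f ⋆ g) n ≈ (g ⋆ f) n
  ⋆-comm f g zero    = *-comm _ _
  ⋆-comm f g (suc n) = begin
    f 0 * g (suc n) + ((f ∘ suc) ⋆ g) n   ≈⟨ +-cong refl (⋆-comm (f ∘ suc) g n) ⟩
    f 0 * g (suc n) + (g ⋆ (f ∘ suc)) n   ≈⟨ +-comm _ _ ⟩
    (g ⋆ (f ∘ suc)) n + f 0 * g (suc n)   ≈⟨ +-cong refl (*-comm _ _) ⟩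
    (g ⋆ (f ∘ suc)) n + g (suc n) * f 0   ≈⟨ ⋆-last g f n ⟨
    (g ⋆ f) (suc n)                       ∎
    where
    ⋆-last : ∀ f g n → (f ⋆ g) (suc n) ≈ (f ⋆ (g ∘ suc)) n + f (suc n) * g 0
    ⋆-last f g zero    = refl
    ⋆-last f g (suc n) = trans (+-cong refl (⋆-last (f ∘ suc) g n)) (sym (+-assoc _ _ _))

  ⋆-assoc : ∀ f g h n → ((f ⋆ g) ⋆ h) n ≈ (f ⋆ (g ⋆ h)) n
  ⋆-assoc f g h zero    = *-assoc _ _ _
  ⋆-assoc f g h (suc n) = begin
    (f ⋆ g) 0 * h (suc n) + ((λ t → f 0 * g (suc t) + ((f ∘ suc) ⋆ g) t) ⋆ h) n
      ≈⟨ +-cong refl (⋆-distribʳ-+ _ _ h n) ⟩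
    (f ⋆ g) 0 * h (suc n) + (((λ t → f 0 * g (suc t)) ⋆ h) n + (((f ∘ suc) ⋆ g) ⋆ h) n)
      ≈⟨ +-cong (*-assoc _ _ _) (+-cong (⋆-*ˡ (f 0) (g ∘ suc) h n) (⋆-assoc (f ∘ suc) g h n)) ⟩
    f 0 * (g 0 * h (suc n)) + (f 0 * ((g ∘ suc) ⋆ h) n + ((f ∘ suc) ⋆ (g ⋆ h)) n)
      ≈⟨ +-assoc _ _ _ ⟨
    (f 0 * (g 0 * h (suc n)) + f 0 * ((g ∘ suc) ⋆ h) n) + ((f ∘ suc) ⋆ (g ⋆ h)) n
      ≈⟨ +-cong (distribˡ _ _ _) refl ⟨
    f 0 * (g ⋆ h) (suc n) + ((f ∘ suc) ⋆ (g ⋆ h)) n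
      ∎

  shift-⋆ : ∀ f g n → (shift f ⋆ g) (suc n) ≈ (f ⋆ g) n
  shift-⋆ f g n = trans (+-cong (zeroˡ _) refl) (+-identityˡ _)

  ⋆-head : ∀ f g n → (f ⋆ g) n ≈ f 0 * g n + (shift (f ∘ suc) ⋆ g) n
  ⋆-head f g zero    = sym (trans (+-cong refl (zeroˡ _)) (+-identityʳ _))
  ⋆-head f g (suc n) = +-cong refl (sym (shift-⋆ (f ∘ suc) g n))

module LaurentSeries {c ℓ} (R : CommutativeRing c ℓ) where
  open CommutativeRing R
  open Setup R
  open Sums R
  open CauchyProduct R

  infix 4 _≋_
  _≋_ : Laurent → Laurent → Set ℓ
  x ≋ y = (Laurent.top x ≡ Laurent.top y) × (∀ n → Laurent.cf x n ≈ Laurent.cf y n)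

  ≋-refl : ∀ {x} → x ≋ x
  ≋-refl = ≡.refl , λ _ → refl

  ≋-trans : ∀ {x y z} → x ≋ y → y ≋ z → x ≋ z
  ≋-trans (t , e) (t′ , e′) = ≡.trans t t′ , λ n → trans (e n) (e′ n)

  ≋⇒≈L : ∀ {x y} → x ≋ y → x ≈L y
  ≋⇒≈L {⟨ k , f ⟩} {⟨ .k , g ⟩} (≡.refl , f≈g) e with (+ k) ℤ.- e
  ... | + n      = f≈g n
  ... | -[1+ _ ] = refl

  shiftCf-cong : ∀ m {f g} → (∀ n → f n ≈ g n) → ∀ n → shiftCf m f n ≈ shiftCf m g n
  shiftCf-cong m f≈g n with n ℕ.<ᵇ m
  ... | true  = refl
  ... | false = f≈g (n ∸ m)

  +L-cong : ∀ {x x′ y y′} → x ≋ x′ → y ≋ y′ → x +L y ≋ x′ +L y′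
  +L-cong {⟨ k , _ ⟩} {⟨ .k , _ ⟩} {⟨ l , _ ⟩} {⟨ .l , _ ⟩} (≡.refl , f≈) (≡.refl , g≈) =
    ≡.refl , λ n → +-cong (shiftCf-cong l f≈ n) (shiftCf-cong k g≈ n)

  -L-cong : ∀ {x x′} → x ≋ x′ → -L x ≋ -L x′
  -L-cong {⟨ k , _ ⟩} {⟨ .k , _ ⟩} (≡.refl , f≈) = ≡.refl , λ n → -‿cong (f≈ n)

  *L-cong : ∀ {x x′ y y′} → x ≋ x′ → y ≋ y′ → x *L y ≋ x′ *L y′
  *L-cong {⟨ k , _ ⟩} {⟨ .k , _ ⟩} {⟨ l , _ ⟩} {⟨ .l , _ ⟩} (≡.refl , f≈) (≡.refl , g≈) =
    ≡.refl , λ n → ∑-cong (upTo (suc n)) (λ i → *-cong (f≈ i) (g≈ (n ∸ i)))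

  cf-*L : ∀ x y n → Laurent.cf (x *L y) n ≈ (Laurent.cf x ⋆ Laurent.cf y) n
  cf-*L ⟨ _ , f ⟩ ⟨ _ , g ⟩ = ∑-upTo-≈-⋆ f g

  cf-series : ∀ g n → Laurent.cf (series g) n ≈ shift g n
  cf-series g zero    = refl
  cf-series g (suc n) = refl

  cf-constL : ∀ x n → Laurent.cf (constL x) n ≈ x * δ₀ n
  cf-constL x zero    = sym (*-identityʳ x)
  cf-constL x (suc n) = sym (zeroʳ x)

  constL-⋆ : ∀ x f n → (Laurent.cf (constL x) ⋆ f) n ≈ x * f n
  constL-⋆ x f n = trans (⋆-cong (cf-constL x) (λ _ → refl) n) (trans (⋆-*ˡ x δ₀ f n) (*-cong refl (⋆-identityˡ f n)))

  sumL-≋ : ∀ {A : Set} (l : List A) (F : A → Laurent) (φ : A → Seq) → (∀ x → F x ≋ ⟨ 0 , φ x ⟩) →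
           sumL (map F l) ≋ ⟨ 0 , (λ t → ∑[ x ∈ l ] φ x t) ⟩
  sumL-≋ []      F φ F≋ = ≡.refl , λ { zero → refl ; (suc _) → refl }
  sumL-≋ (x ∷ l) F φ F≋ = ≋-trans (+L-cong (F≋ x) (sumL-≋ l F φ F≋)) ≋-refl

  ⟨1,shift-δ₀⟩≈1L : ∀ {h} → (∀ n → h n ≈ shift δ₀ n) → ⟨ 1 , h ⟩ ≈L 1L
  ⟨1,shift-δ₀⟩≈1L h≈ (+ zero)          = h≈ 1
  ⟨1,shift-δ₀⟩≈1L h≈ (+ suc zero)      = h≈ 0
  ⟨1,shift-δ₀⟩≈1L h≈ (+ suc (suc n))   = refl
  ⟨1,shift-δ₀⟩≈1L h≈ -[1+ n ]          = h≈ (suc (suc n))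

module Paths {c ℓ} (R : CommutativeRing c ℓ) (p : ℕ) (a : Fin (suc p) → ℤ → CommutativeRing.Carrier R) where
  open CommutativeRing R
  open Setup R
  open Sums R
  open CauchyProduct R

  transfer : (ℤ → Carrier) → ℤ → Carrier
  transfer F h = 1# * F (h ℤ.+ + 1) + ∑[ j ∈ allFin (suc p) ] (a j (h ℤ.- + toℕ j) * F (h ℤ.- + toℕ j))

  transfer-cong : ∀ {F G} h → (∀ h′ → F h′ ≈ G h′) → transfer F h ≈ transfer G h
  transfer-cong h F≈G = +-cong (*-cong refl (F≈G _)) (∑-cong (allFin (suc p)) (λ j → *-cong refl (F≈G _)))

  transfer-zero : ∀ h → transfer (λ _ → 0#) h ≈ 0#
  transfer-zero h = trans (+-cong (zeroʳ _) (∑-zero (allFin (suc p)) (λ j → zeroʳ _))) (+-identityˡ _)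

  transfer-distrib-+ : ∀ F G h → transfer (λ h′ → F h′ + G h′) h ≈ transfer F h + transfer G h
  transfer-distrib-+ F G h = trans
    (+-cong (distribˡ _ _ _) (trans (∑-cong (allFin (suc p)) (λ j → distribˡ _ _ _)) (∑-distrib-+ (allFin (suc p)) _ _)))
    (interchange _ _ _ _)
    where open CommutativeSemigroupProperties +-commutativeSemigroup using (interchange)

  transfer-*ˡ : ∀ x F h → transfer (λ h′ → x * F h′) h ≈ x * transfer F h
  transfer-*ˡ x F h = trans
    (+-cong (x∙yz≈y∙xz _ _ _) (trans (∑-cong (allFin (suc p)) (λ j → x∙yz≈y∙xz _ _ _)) (sym (*-distribˡ-∑ (allFin (suc p)) x _))))
    (sym (distribˡ _ _ _))
    where open CommutativeSemigroupProperties *-commutativeSemigroup using (x∙yz≈y∙xz)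

  transfer-∑ : ∀ {A : Set} (l : List A) (F : A → ℤ → Carrier) h →
               transfer (λ h′ → ∑[ x ∈ l ] F x h′) h ≈ ∑[ x ∈ l ] transfer (F x) h
  transfer-∑ []      F h = transfer-zero h
  transfer-∑ (x ∷ l) F h = trans (transfer-distrib-+ (F x) (λ h′ → ∑[ y ∈ l ] F y h′) h) (+-cong refl (transfer-∑ l F h))

  transfer-⋆ : ∀ (F : ℤ → Seq) g h n → ((λ t → transfer (λ h′ → F h′ t) h) ⋆ g) n ≈ transfer (λ h′ → (F h′ ⋆ g) n) h
  transfer-⋆ F g h n = trans (⋆-distribʳ-+ _ _ g n) (+-cong (⋆-*ˡ 1# _ g n)
    (trans (⋆-∑ˡ (allFin (suc p)) _ g n) (∑-cong (allFin (suc p)) (λ j → ⋆-*ˡ _ _ g n))))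

  ∑-seqs-suc : ∀ n (F : List (Step p) → Carrier) →
               ∑ (seqs p (suc n)) F ≈ ∑ (seqs p n) (F ∘ (up ∷_)) + ∑[ j ∈ allFin (suc p) ] ∑ (seqs p n) (F ∘ (dn j ∷_))
  ∑-seqs-suc n F = trans (∑-concatMap (allSteps p) (λ s → map (s ∷_) (seqs p n)) F)
    (+-cong (reflexive (∑-map (seqs p n) (up ∷_) F))
            (trans (reflexive (∑-map (allFin (suc p)) dn _))
                   (∑-cong (allFin (suc p)) (λ j → reflexive (∑-map (seqs p n) (dn j ∷_) F)))))

  module Constrained (ok : ℤ → Bool) where

    admissible : ℤ → List (Step p) → Bool
    admissible h []       = ok h
    admissible h (s ∷ ss) = ok h ∧ admissible (h ℤ.+ δ s) ss

    contribution : ℤ → ℤ → List (Step p) → Carrier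
    contribution h e ss = if (endH h ss == e) ∧ admissible h ss then weight a h ss else 0#

    pathSum : ℤ → ℕ → ℤ → Carrier
    pathSum h n e = ∑ (seqs p n) (contribution h e)

    pathSum-zero : ∀ h e → pathSum h 0 e ≈ (if (h == e) ∧ ok h then 1# else 0#)
    pathSum-zero h e = +-identityʳ _

    pathSum-blocked : ∀ h n e → ok h ≡ false → pathSum h n e ≈ 0#
    pathSum-blocked h n e blocked = ∑-zero (seqs p n) λ ss →
      reflexive (cong (λ b → if b then weight a h ss else 0#)
                      (≡.trans (cong ((endH h ss == e) ∧_) (inadmissible ss)) (∧-zeroʳ (endH h ss == e))))
      where
      inadmissible : ∀ ss → admissible h ss ≡ false
      inadmissible []      = blocked
      inadmissible (s ∷ ss) rewrite blocked = ≡.refl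

    pathSum-suc : ∀ h n e → ok h ≡ true → pathSum h (suc n) e ≈ transfer (λ h′ → pathSum h′ n e) h
    pathSum-suc h n e open′ = begin
      pathSum h (suc n) e
        ≈⟨ ∑-seqs-suc n (contribution h e) ⟩
      ∑ (seqs p n) (contribution h e ∘ (up ∷_)) + ∑[ j ∈ allFin (suc p) ] ∑ (seqs p n) (contribution h e ∘ (dn j ∷_))
        ≈⟨ +-cong (trans (∑-cong (seqs p n) (contribution-up)) (sym (*-distribˡ-∑ (seqs p n) 1# _)))
                  (∑-cong (allFin (suc p)) λ j →
                     trans (∑-cong (seqs p n) (contribution-dn j)) (sym (*-distribˡ-∑ (seqs p n) _ _))) ⟩
      transfer (λ h′ → pathSum h′ n e) h ∎
      where
      open import Relation.Binary.Reasoning.Setoid setoid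
      contribution-up : ∀ ss → contribution h e (up ∷ ss) ≈ 1# * contribution (h ℤ.+ + 1) e ss
      contribution-up ss rewrite open′ = sym (*-if _ _ _)
      contribution-dn : ∀ j ss → contribution h e (dn j ∷ ss) ≈ a j (h ℤ.- + toℕ j) * contribution (h ℤ.- + toℕ j) e ss
      contribution-dn j ss rewrite open′ = sym (*-if _ _ _)

    pathSum-zero-≢ : ∀ {h e} → h ≢ e → pathSum h 0 e ≈ 0#
    pathSum-zero-≢ {h} {e} h≢e = trans (pathSum-zero h e) (if-cong (cong (_∧ ok h) (⌊⌋-false (h ℤ.≟ e) h≢e)) refl)

    pathSum-zero-refl : ∀ {h} → ok h ≡ true → pathSum h 0 h ≈ 1#
    pathSum-zero-refl {h} open′ = trans (pathSum-zero h h) (if-cong (≡.cong₂ _∧_ (⌊⌋-true (h ℤ.≟ h) ≡.refl) open′) refl)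

  module Free = Constrained (λ _ → true)
  module Above (floor : ℤ) = Constrained (λ h → ⌊ floor ℤ.≤? h ⌋)
  module Below (ceiling : ℤ) = Constrained (λ h → ⌊ h ℤ.≤? ceiling ⌋)

  Free-admissible : ∀ h ss → Free.admissible h ss ≡ true
  Free-admissible h []       = ≡.refl
  Free-admissible h (s ∷ ss) = Free-admissible _ ss

  Above-admissible : ∀ f h ss → Above.admissible f h ss ≡ ⌊ f ℤ.≤? minH h ss ⌋
  Above-admissible f h []       = ≡.refl
  Above-admissible f h (s ∷ ss) =
    ≡.trans (cong (⌊ f ℤ.≤? h ⌋ ∧_) (Above-admissible f _ ss)) (≡.sym (≤ᵇ-⊓ f h _))

  Below-admissible : ∀ c h ss → Below.admissible c h ss ≡ ⌊ maxH h ss ℤ.≤? c ⌋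
  Below-admissible c h []       = ≡.refl
  Below-admissible c h (s ∷ ss) =
    ≡.trans (cong (⌊ h ℤ.≤? c ⌋ ∧_) (Below-admissible c _ ss)) (≡.sym (⊔-≤ᵇ h _ c))

  Wc≈Free : ∀ n j → Wc p a n j ≈ Free.pathSum (+ 0) n (+ j)
  Wc≈Free n j = ∑-cong (seqs p n) λ ss →
    if-cong (≡.sym (≡.trans (cong ((endH (+ 0) ss == + j) ∧_) (Free-admissible (+ 0) ss)) (∧-identityʳ _))) refl

  Ac≈Above : ∀ q n j → Ac p a q n j ≈ Above.pathSum (+ q) (+ q) n (+ (j ℕ.+ q))
  Ac≈Above q n j = ∑-cong (seqs p n) λ ss → if-cong (≡.cong₂ _∧_ (end ss) (min ss)) refl
    where
    end : ∀ ss → (endH (+ 0) ss == + j) ≡ (endH (+ q) ss == + (j ℕ.+ q))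
    end ss = ≡.trans (==-+ (+ q) _ _) (cong (_== + (j ℕ.+ q)) (≡.sym (endH-+ (+ q) (+ 0) ss)))
    min : ∀ ss → (minH (+ 0) ss == + 0) ≡ Above.admissible (+ q) (+ q) ss
    min ss = begin
      (minH (+ 0) ss == + 0)                ≡⟨ ==-as-≥ (minH≤start (+ 0) ss) ⟩
      ⌊ + 0 ℤ.≤? minH (+ 0) ss ⌋            ≡⟨ ≤ᵇ-+ (+ q) _ _ ⟩
      ⌊ + q ℤ.≤? minH (+ 0) ss ℤ.+ + q ⌋    ≡⟨ cong (λ x → ⌊ + q ℤ.≤? x ⌋) (minH-+ (+ q) (+ 0) ss) ⟨
      ⌊ + q ℤ.≤? minH (+ q) ss ⌋            ≡⟨ Above-admissible (+ q) (+ q) ss ⟨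
      Above.admissible (+ q) (+ q) ss       ∎
      where open ≡.≡-Reasoning

  Bc≈Below : ∀ q n k → Bc p a q n k ≈ Below.pathSum (ℤ.- + q) (ℤ.- + k ℤ.- + q) n (ℤ.- + q)
  Bc≈Below q n k = ∑-cong (seqs p n) λ ss → if-cong (condition ss) refl
    where
    -q = ℤ.- + q
    0-q≡-q : + 0 ℤ.+ -q ≡ -q
    0-q≡-q = ℤP.+-identityˡ -q
    condition : ∀ ss → ((endH (ℤ.- + k) ss == + 0) ∧ (maxH (ℤ.- + k) ss == + 0))
                     ≡ ((endH (ℤ.- + k ℤ.- + q) ss == -q) ∧ Below.admissible -q (ℤ.- + k ℤ.- + q) ss)
    condition ss = begin
      (endH (ℤ.- + k) ss == + 0) ∧ (maxH (ℤ.- + k) ss == + 0)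
        ≡⟨ ==-∧-== _ _ (+ 0) (endH≤maxH (ℤ.- + k) ss) ⟩
      (endH (ℤ.- + k) ss == + 0) ∧ ⌊ maxH (ℤ.- + k) ss ℤ.≤? + 0 ⌋
        ≡⟨ ≡.cong₂ _∧_ (==-+ -q (endH (ℤ.- + k) ss) (+ 0)) (≤ᵇ-+ -q (maxH (ℤ.- + k) ss) (+ 0)) ⟩
      (endH (ℤ.- + k) ss ℤ.+ -q == + 0 ℤ.+ -q) ∧ ⌊ maxH (ℤ.- + k) ss ℤ.+ -q ℤ.≤? + 0 ℤ.+ -q ⌋
        ≡⟨ ≡.cong₂ _∧_ (≡.cong₂ _==_ (≡.sym (endH-+ -q _ ss)) 0-q≡-q)
                       (≡.cong₂ (λ x y → ⌊ x ℤ.≤? y ⌋) (≡.sym (maxH-+ -q _ ss)) 0-q≡-q) ⟩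
      (endH (ℤ.- + k ℤ.- + q) ss == -q) ∧ ⌊ maxH (ℤ.- + k ℤ.- + q) ss ℤ.≤? -q ⌋
        ≡⟨ cong ((endH (ℤ.- + k ℤ.- + q) ss == -q) ∧_) (Below-admissible -q _ ss) ⟨
      (endH (ℤ.- + k ℤ.- + q) ss == -q) ∧ Below.admissible -q (ℤ.- + k ℤ.- + q) ss ∎
      where open ≡.≡-Reasoning

module Decompositions {c ℓ} (R : CommutativeRing c ℓ) (p : ℕ) (a : Fin (suc p) → ℤ → CommutativeRing.Carrier R) where
  open CommutativeRing R
  open Setup R
  open Sums R
  open CauchyProduct R
  open Paths R p a
  open import Relation.Binary.Reasoning.Setoid setoid

  G : ℤ → ℕ → ℤ → Carrier
  G = Free.pathSum

  G-suc : ∀ h n e → G h (suc n) e ≈ transfer (λ h′ → G h′ n e) h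
  G-suc h n e = Free.pathSum-suc h n e ≡.refl

  G-zero-≢ : ∀ {h e} → h ≢ e → G h 0 e ≈ 0#
  G-zero-≢ = Free.pathSum-zero-≢

  G-zero-refl : ∀ h → G h 0 h ≈ 1#
  G-zero-refl h = Free.pathSum-zero-refl ≡.refl

  -- A path ending above level i either stays above i, or it is at level i at its last
  -- visit to heights ≤ i (only upsteps climb, and by exactly one) and then stays above i.
  module LastExit (i : ℕ) {e : ℤ} (i<e : + i ℤ.< e) where

    U : ℤ → ℕ → Carrier
    U h n = Above.pathSum (+ suc i) h n e

    ascent : Seq
    ascent = shift (U (+ suc i))

    U-blocked : ∀ {h} n → h ℤ.≤ + i → U h n ≈ 0#
    U-blocked n h≤i = Above.pathSum-blocked (+ suc i) _ n e (above-closed i h≤i)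

    transfer-U-below : ∀ {h} N → h ℤ.≤ + i → transfer (λ h′ → U h′ N) h ≈ U (h ℤ.+ + 1) N
    transfer-U-below {h} N h≤i = trans
      (+-cong (*-identityˡ _) (∑-zero (allFin (suc p)) λ j →
        trans (*-cong refl (U-blocked N (ℤP.≤-trans (ℤP.i-j≤i h (+ toℕ j)) h≤i))) (zeroʳ _)))
      (+-identityʳ _)

    transfer-U : ∀ h N → transfer (λ h′ → U h′ N) h ≈ U h (suc N) + G h 0 (+ i) * U (+ suc i) N
    transfer-U h N with ℤP.<-cmp (+ i) h
    ... | tri< i<h _ _ = begin
      transfer (λ h′ → U h′ N) h               ≈⟨ Above.pathSum-suc (+ suc i) h N e (above-open i i<h) ⟨
      U h (suc N)                              ≈⟨ +-identityʳ _ ⟨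
      U h (suc N) + 0#                         ≈⟨ +-cong refl (trans (*-cong (G-zero-≢ (λ h≡i → ℤP.<⇒≢ i<h (≡.sym h≡i))) refl) (zeroˡ _)) ⟨
      U h (suc N) + G h 0 (+ i) * U (+ suc i) N ∎
    ... | tri≈ _ ≡.refl _ = begin
      transfer (λ h′ → U h′ N) (+ i)           ≈⟨ transfer-U-below N ℤP.≤-refl ⟩
      U (+ i ℤ.+ + 1) N                        ≡⟨ cong (λ x → U (+ x) N) (ℕP.+-comm i 1) ⟩
      U (+ suc i) N                            ≈⟨ *-identityˡ _ ⟨
      1# * U (+ suc i) N                       ≈⟨ +-identityˡ _ ⟨
      0# + 1# * U (+ suc i) N                  ≈⟨ +-cong (U-blocked (suc N) ℤP.≤-refl) (*-cong (G-zero-refl (+ i)) refl) ⟨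
      U (+ i) (suc N) + G (+ i) 0 (+ i) * U (+ suc i) N ∎
    ... | tri> _ _ h<i = begin
      transfer (λ h′ → U h′ N) h               ≈⟨ transfer-U-below N (ℤP.<⇒≤ h<i) ⟩
      U (h ℤ.+ + 1) N                          ≈⟨ U-blocked N (≡.subst (ℤ._≤ + i) (ℤP.+-comm (+ 1) h) (ℤP.i<j⇒suc[i]≤j h<i)) ⟩
      0#                                       ≈⟨ +-identityˡ _ ⟨
      0# + 0#                                  ≈⟨ +-cong (U-blocked (suc N) (ℤP.<⇒≤ h<i))
                                                         (trans (*-cong (G-zero-≢ (ℤP.<⇒≢ h<i)) refl) (zeroˡ _)) ⟨
      U h (suc N) + G h 0 (+ i) * U (+ suc i) N ∎

    lastExit : ∀ N h → G h N e ≈ U h N + ((λ n → G h n (+ i)) ⋆ ascent) N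
    lastExit zero h = base h (h ℤ.≟ e)
      where
      base : ∀ h → Dec (h ≡ e) → G h 0 e ≈ U h 0 + G h 0 (+ i) * 0#
      base h (yes ≡.refl) = trans (G-zero-refl h) (sym (trans (+-cong U-zero (zeroʳ _)) (+-identityʳ _)))
        where U-zero = Above.pathSum-zero-refl (+ suc i) (⌊⌋-true (_ ℤ.≤? _) (ℤP.i<j⇒suc[i]≤j i<e))
      base h (no h≢e) =
        trans (G-zero-≢ h≢e) (sym (trans (+-cong (Above.pathSum-zero-≢ (+ suc i) h≢e) (zeroʳ _)) (+-identityʳ _)))
    lastExit (suc N) h = begin
      G h (suc N) e
        ≈⟨ G-suc h N e ⟩
      transfer (λ h′ → G h′ N e) h
        ≈⟨ transfer-cong h (lastExit N) ⟩
      transfer (λ h′ → U h′ N + (g h′ ⋆ ascent) N) h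
        ≈⟨ transfer-distrib-+ (λ h′ → U h′ N) (λ h′ → (g h′ ⋆ ascent) N) h ⟩
      transfer (λ h′ → U h′ N) h + transfer (λ h′ → (g h′ ⋆ ascent) N) h
        ≈⟨ +-cong (transfer-U h N) (sym (transfer-⋆ g ascent h N)) ⟩
      (U h (suc N) + g h 0 * U (+ suc i) N) + ((λ n → transfer (λ h′ → g h′ n) h) ⋆ ascent) N
        ≈⟨ +-assoc _ _ _ ⟩
      U h (suc N) + (g h 0 * U (+ suc i) N + ((λ n → transfer (λ h′ → g h′ n) h) ⋆ ascent) N)
        ≈⟨ +-cong refl (+-cong refl (⋆-cong (λ n → G-suc h n (+ i)) (λ _ → refl) N)) ⟨
      U h (suc N) + (g h ⋆ ascent) (suc N) ∎
      where
      g : ℤ → Seq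
      g h n = G h n (+ i)

  -- A path from h ≤ 0 to 0 first reaches 0 by an upstep from -1, staying at heights ≤ -1 before.
  module FirstAscent where

    M : ℤ → ℕ → Carrier
    M h n = Below.pathSum -[1+ 0 ] h n -[1+ 0 ]

    arrival : ℤ → Seq
    arrival h zero    = G h 0 (+ 0)
    arrival h (suc t) = M h t

    returns : Seq
    returns n = G (+ 0) n (+ 0)

    arrival-0≈δ₀ : ∀ t → arrival (+ 0) t ≈ δ₀ t
    arrival-0≈δ₀ zero    = G-zero-refl (+ 0)
    arrival-0≈δ₀ (suc t) = Below.pathSum-blocked -[1+ 0 ] (+ 0) t -[1+ 0 ] ≡.refl

    negative≢0 : ∀ {x m} → x ℤ.≤ -[1+ m ] → x ≢ + 0
    negative≢0 () ≡.refl

    arrival-transfer : ∀ m t → arrival -[1+ m ] (suc t) ≈ transfer (λ h′ → arrival h′ t) -[1+ m ]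
    arrival-transfer m (suc t) = Below.pathSum-suc -[1+ 0 ] -[1+ m ] t -[1+ 0 ] (⌊⌋-true (-[1+ m ] ℤ.≤? -[1+ 0 ]) (ℤ.-≤- z≤n))
    arrival-transfer m zero    = begin
      M -[1+ m ] 0
        ≈⟨ Below.pathSum-zero -[1+ 0 ] -[1+ m ] -[1+ 0 ] ⟩
      (if (-[1+ m ] == -[1+ 0 ]) ∧ ⌊ -[1+ m ] ℤ.≤? -[1+ 0 ] ⌋ then 1# else 0#)
        ≈⟨ if-cong (≡.cong₂ _∧_ (==-+ (+ 1) -[1+ m ] -[1+ 0 ]) (⌊⌋-true (-[1+ m ] ℤ.≤? -[1+ 0 ]) (ℤ.-≤- z≤n))) refl ⟩
      (if (-[1+ m ] ℤ.+ + 1 == + 0) ∧ true then 1# else 0#)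
        ≈⟨ Free.pathSum-zero (-[1+ m ] ℤ.+ + 1) (+ 0) ⟨
      G (-[1+ m ] ℤ.+ + 1) 0 (+ 0)
        ≈⟨ *-identityˡ _ ⟨
      1# * G (-[1+ m ] ℤ.+ + 1) 0 (+ 0)
        ≈⟨ +-identityʳ _ ⟨
      1# * G (-[1+ m ] ℤ.+ + 1) 0 (+ 0) + 0#
        ≈⟨ +-cong refl (∑-zero (allFin (suc p)) λ j →
             trans (*-cong refl (G-zero-≢ (negative≢0 (ℤP.i-j≤i -[1+ m ] (+ toℕ j))))) (zeroʳ _)) ⟨
      transfer (λ h′ → arrival h′ 0) -[1+ m ] ∎

    firstAscent : ∀ N h → h ℤ.≤ + 0 → G h N (+ 0) ≈ (arrival h ⋆ returns) N
    firstAscent N       (+ zero)  _          = sym (trans (⋆-cong arrival-0≈δ₀ (λ _ → refl) N) (⋆-identityˡ returns N))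
    firstAscent N       (+ suc m) (ℤ.+≤+ ())
    firstAscent zero    -[1+ m ]  _          = trans −m≠0 (sym (trans (*-cong −m≠0 refl) (zeroˡ _)))
      where −m≠0 = G-zero-≢ { -[1+ m ]} {+ 0} (λ ())
    firstAscent (suc N) -[1+ m ]  _          = begin
      G -[1+ m ] (suc N) (+ 0)
        ≈⟨ G-suc -[1+ m ] N (+ 0) ⟩
      transfer (λ h′ → G h′ N (+ 0)) -[1+ m ]
        ≈⟨ +-cong (*-cong refl (firstAscent N _ (up≤0 m)))
                  (∑-cong (allFin (suc p)) λ j → *-cong refl (firstAscent N _ (down≤0 (toℕ j)))) ⟩
      transfer (λ h′ → (arrival h′ ⋆ returns) N) -[1+ m ]
        ≈⟨ transfer-⋆ arrival returns -[1+ m ] N ⟨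
      ((λ t → transfer (λ h′ → arrival h′ t) -[1+ m ]) ⋆ returns) N
        ≈⟨ ⋆-cong (λ t → arrival-transfer m t) (λ _ → refl) N ⟨
      ((arrival -[1+ m ] ∘ suc) ⋆ returns) N
        ≈⟨ shift-⋆ (arrival -[1+ m ] ∘ suc) returns N ⟨
      (shift (arrival -[1+ m ] ∘ suc) ⋆ returns) (suc N)
        ≈⟨ ⋆-cong {f = arrival -[1+ m ]} {shift (arrival -[1+ m ] ∘ suc)} {returns} (λ { zero → G-zero-≢ { -[1+ m ]} {+ 0} (λ ()) ; (suc _) → refl }) (λ _ → refl) (suc N) ⟨
      (arrival -[1+ m ] ⋆ returns) (suc N) ∎
      where
      up≤0 : ∀ m → -[1+ m ] ℤ.+ + 1 ℤ.≤ + 0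
      up≤0 zero    = ℤP.≤-refl
      up≤0 (suc m) = ℤ.-≤+
      down≤0 : ∀ j → -[1+ m ] ℤ.- + j ℤ.≤ + 0
      down≤0 j = ℤP.≤-trans (ℤP.i-j≤i -[1+ m ] (+ j)) ℤ.-≤+

  -- A path from h ≥ 1 to 0 first leaves the heights ≥ 1 by a step of some size j, from a height
  -- j - k ≥ 1 down to -k ≤ 0; k < j indexes the possible landing heights.
  module FirstDescent where

    U₁ : ℤ → ℕ → ℤ → Carrier
    U₁ = Above.pathSum (+ 1)

    toZero : ℕ → Seq
    toZero k n = G (ℤ.- + k) n (+ 0)

    descentTerm : ℤ → ℕ → Fin (suc p) → ℕ → Carrier
    descentTerm h N j k = a j (ℤ.- + k) * (shift (λ m → U₁ h m (+ (toℕ j ∸ k))) ⋆ toZero k) N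

    firstDescent : ℤ → ℕ → Carrier
    firstDescent h N = ∑[ j ∈ allFin (suc p) ] ∑[ k ∈ upTo (toℕ j) ] descentTerm h N j k

    immediateTerm : ℤ → ℕ → Fin (suc p) → ℕ → Carrier
    immediateTerm h N j k = a j (ℤ.- + k) * (U₁ h 0 (+ (toℕ j ∸ k)) * toZero k N)

    immediateDescent : ℤ → ℕ → Carrier
    immediateDescent h N = ∑[ j ∈ allFin (suc p) ] ∑ (upTo (toℕ j)) (immediateTerm h N j)

    ∑∑-zero : ∀ {F : Fin (suc p) → ℕ → Carrier} → (∀ j k → F j k ≈ 0#) →
              ∑[ j ∈ allFin (suc p) ] ∑[ k ∈ upTo (toℕ j) ] F j k ≈ 0#
    ∑∑-zero F≈0 = ∑-zero (allFin (suc p)) λ j → ∑-zero (upTo (toℕ j)) (F≈0 j)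

    firstDescent-zero : ∀ h → firstDescent h 0 ≈ 0#
    firstDescent-zero h = ∑∑-zero λ j k → trans (*-cong refl (zeroˡ _)) (zeroʳ _)

    firstDescent-blocked : ∀ {h} N → h ℤ.≤ + 0 → firstDescent h N ≈ 0#
    firstDescent-blocked {h} N h≤0 = ∑∑-zero λ j k → trans (*-cong refl (⋆-zeroˡ _ _ U₁-blocked N)) (zeroʳ _)
      where
      U₁-blocked : ∀ {g} t → shift (λ m → U₁ h m g) t ≈ 0#
      U₁-blocked zero    = refl
      U₁-blocked (suc t) = Above.pathSum-blocked (+ 1) h t _ (above-closed 0 h≤0)

    firstDescent-suc : ∀ {h} N → + 0 ℤ.< h →
                       firstDescent h (suc N) ≈ immediateDescent h N + transfer (λ h′ → firstDescent h′ N) h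
    firstDescent-suc {h} N 0<h = begin
      firstDescent h (suc N)
        ≈⟨ ∑-cong (allFin (suc p)) (λ j → trans (∑-cong (upTo (toℕ j)) (descentTerm-suc j))
                                               (∑-distrib-+ (upTo (toℕ j)) _ _)) ⟩
      ∑[ j ∈ allFin (suc p) ] (∑ (upTo (toℕ j)) (immediateTerm h N j)
                               + ∑[ k ∈ upTo (toℕ j) ] transfer (λ h′ → descentTerm h′ N j k) h)
        ≈⟨ ∑-distrib-+ (allFin (suc p)) _ _ ⟩
      immediateDescent h N + ∑[ j ∈ allFin (suc p) ] ∑[ k ∈ upTo (toℕ j) ] transfer (λ h′ → descentTerm h′ N j k) h
        ≈⟨ +-cong refl (trans (transfer-∑ (allFin (suc p)) (λ j h′ → ∑[ k ∈ upTo (toℕ j) ] descentTerm h′ N j k) h)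
                              (∑-cong (allFin (suc p)) λ j → transfer-∑ (upTo (toℕ j)) (λ k h′ → descentTerm h′ N j k) h)) ⟨
      immediateDescent h N + transfer (λ h′ → firstDescent h′ N) h ∎
      where
      descentTerm-suc : ∀ j k → descentTerm h (suc N) j k ≈ immediateTerm h N j k + transfer (λ h′ → descentTerm h′ N j k) h
      descentTerm-suc j k = begin
        a j (ℤ.- + k) * (shift V ⋆ toZero k) (suc N)
          ≈⟨ *-cong refl (trans (shift-⋆ V (toZero k) N) (⋆-head V (toZero k) N)) ⟩
        a j (ℤ.- + k) * (V 0 * toZero k N + (shift (V ∘ suc) ⋆ toZero k) N)
          ≈⟨ distribˡ _ _ _ ⟩
        a j (ℤ.- + k) * (V 0 * toZero k N) + a j (ℤ.- + k) * (shift (V ∘ suc) ⋆ toZero k) N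
          ≈⟨ +-cong refl (*-cong refl (trans (⋆-cong V-suc (λ _ → refl) N) (transfer-⋆ (λ h′ → shift (λ m → U₁ h′ m g)) (toZero k) h N))) ⟩
        a j (ℤ.- + k) * (V 0 * toZero k N) + a j (ℤ.- + k) * transfer (λ h′ → (shift (λ m → U₁ h′ m g) ⋆ toZero k) N) h
          ≈⟨ +-cong refl (transfer-*ˡ _ (λ h′ → (shift (λ m → U₁ h′ m g) ⋆ toZero k) N) h) ⟨
        a j (ℤ.- + k) * (V 0 * toZero k N) + transfer (λ h′ → descentTerm h′ N j k) h ∎
        where
        g = + (toℕ j ∸ k)
        V = λ m → U₁ h m g
        V-suc : ∀ t → shift (V ∘ suc) t ≈ transfer (λ h′ → shift (λ m → U₁ h′ m g) t) h
        V-suc zero    = sym (transfer-zero h)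
        V-suc (suc t) = Above.pathSum-suc (+ 1) h t g (above-open 0 0<h)

    outside : ℕ → ℤ → Carrier
    outside N h = if ⌊ h ℤ.≤? + 0 ⌋ then G h N (+ 0) else 0#

    outside-after-step : ∀ N n j (A : ℤ → Carrier) → A (+ suc n ℤ.- + j) * outside N (+ suc n ℤ.- + j)
                         ≈ (if ⌊ suc n ℕ.≤? j ⌋ then A (ℤ.- + (j ∸ suc n)) * toZero (j ∸ suc n) N else 0#)
    outside-after-step N n j A with suc n ℕ.≤? j
    ... | yes n<j = trans (reflexive (cong (λ x → A x * outside N x) h-j≡-[j-h]))
                          (*-cong refl (if-cong (⌊⌋-true (_ ℤ.≤? _) ℤP.neg-≤-pos) refl))
      where h-j≡-[j-h] = ≡.trans (ℤP.[+m]-[+n]≡m⊖n (suc n) j) (ℤP.⊖-≤ n<j)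
    ... | no n≮j = trans (reflexive (cong (λ x → A x * outside N x) h-j≡h∸j))
                         (trans (*-cong refl (if-cong (⌊⌋-false (_ ℤ.≤? _) (ℤP.<⇒≱ (ℤ.+<+ 0<h∸j))) refl)) (zeroʳ _))
      where
      j<h = ℕP.≰⇒> n≮j
      h-j≡h∸j = ≡.trans (ℤP.[+m]-[+n]≡m⊖n (suc n) j) (ℤP.⊖-≥ (ℕP.<⇒≤ j<h))
      0<h∸j = ℕP.m<n⇒0<n∸m j<h

    immediateTerm-select : ∀ n N j k →
      immediateTerm (+ suc n) N j k ≈ (if (+ suc n == + (toℕ j ∸ k)) then a j (ℤ.- + k) * toZero k N else 0#)
    immediateTerm-select n N j k = begin
      a j (ℤ.- + k) * (U₁ h 0 (+ (toℕ j ∸ k)) * toZero k N)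
        ≈⟨ *-cong refl (*-cong (trans (Above.pathSum-zero (+ 1) h _) (if-cong h-open refl)) refl) ⟩
      a j (ℤ.- + k) * ((if (h == + (toℕ j ∸ k)) then 1# else 0#) * toZero k N)
        ≈⟨ *-cong refl (trans (*-comm _ _) (*-if _ _ _)) ⟩
      a j (ℤ.- + k) * (if (h == + (toℕ j ∸ k)) then toZero k N * 1# else 0#)
        ≈⟨ *-if _ _ _ ⟩
      (if (h == + (toℕ j ∸ k)) then a j (ℤ.- + k) * (toZero k N * 1#) else 0#)
        ≈⟨ if-cong ≡.refl (*-cong refl (*-identityʳ _)) ⟩
      (if (h == + (toℕ j ∸ k)) then a j (ℤ.- + k) * toZero k N else 0#) ∎
      where
      h = + suc n
      h-open = ≡.trans (cong ((h == + (toℕ j ∸ k)) ∧_) (⌊⌋-true (+ 1 ℤ.≤? h) (ℤ.+≤+ (s≤s z≤n)))) (∧-identityʳ _)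

    transfer-outside : ∀ N n → transfer (outside N) (+ suc n) ≈ immediateDescent (+ suc n) N
    transfer-outside N n = trans
      (+-cong (trans (*-cong refl (if-cong {x = G (h ℤ.+ + 1) N (+ 0)} (⌊⌋-false (h ℤ.+ + 1 ℤ.≤? + 0) (ℤP.<⇒≱ (ℤ.+<+ (s≤s z≤n)))) refl)) (zeroʳ _)) refl)
      (trans (+-identityˡ _) (∑-cong (allFin (suc p)) jump-by))
      where
      h = + suc n
      jump-by : ∀ j → a j (h ℤ.- + toℕ j) * outside N (h ℤ.- + toℕ j) ≈ ∑ (upTo (toℕ j)) (immediateTerm h N j)
      jump-by j = begin
        a j (h ℤ.- + toℕ j) * outside N (h ℤ.- + toℕ j)
          ≈⟨ outside-after-step N n (toℕ j) (a j) ⟩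
        (if ⌊ suc n ℕ.≤? toℕ j ⌋ then a j (ℤ.- + (toℕ j ∸ suc n)) * toZero (toℕ j ∸ suc n) N else 0#)
          ≈⟨ ∑<-select n (toℕ j) (λ k → a j (ℤ.- + k) * toZero k N) ⟨
        ∑< (toℕ j) (λ k → if (h == + (toℕ j ∸ k)) then a j (ℤ.- + k) * toZero k N else 0#)
          ≈⟨ ∑<-cong (toℕ j) (λ k _ → immediateTerm-select n N j k) ⟨
        ∑< (toℕ j) (immediateTerm h N j)
          ≡⟨ ∑-upTo (toℕ j) _ ⟨
        ∑ (upTo (toℕ j)) (immediateTerm h N j) ∎

    G≈firstDescent : ∀ N h → + 0 ℤ.< h → G h N (+ 0) ≈ firstDescent h N
    G≈firstDescent zero    h       0<h = trans (G-zero-≢ (λ h≡0 → ℤP.<⇒≢ 0<h (≡.sym h≡0))) (sym (firstDescent-zero h))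
    G≈firstDescent (suc N) (+ zero) (ℤ.+<+ ())
    G≈firstDescent (suc N) (+ suc n) 0<h = begin
      G h (suc N) (+ 0)                                                ≈⟨ G-suc h N (+ 0) ⟩
      transfer (λ h′ → G h′ N (+ 0)) h                                 ≈⟨ transfer-cong h split ⟩
      transfer (λ h′ → firstDescent h′ N + outside N h′) h              ≈⟨ transfer-distrib-+ (λ h′ → firstDescent h′ N) (outside N) h ⟩
      transfer (λ h′ → firstDescent h′ N) h + transfer (outside N) h    ≈⟨ +-comm _ _ ⟩
      transfer (outside N) h + transfer (λ h′ → firstDescent h′ N) h    ≈⟨ +-cong (transfer-outside N n) refl ⟩
      immediateDescent h N + transfer (λ h′ → firstDescent h′ N) h      ≈⟨ firstDescent-suc N 0<h ⟨
      firstDescent h (suc N)                                           ∎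
      where
      h = + suc n
      split : ∀ h′ → G h′ N (+ 0) ≈ firstDescent h′ N + outside N h′
      split h′ with h′ ℤ.≤? + 0
      ... | yes h′≤0 = sym (trans (+-cong (firstDescent-blocked N h′≤0) refl) (+-identityˡ _))
      ... | no h′≰0  = trans (G≈firstDescent N h′ (ℤP.≰⇒> h′≰0)) (sym (+-identityʳ _))

module Identities {c ℓ} (R : CommutativeRing c ℓ) (p : ℕ) (a : Fin (suc p) → ℤ → CommutativeRing.Carrier R) where
  open CommutativeRing R
  open Setup R
  open Sums R
  open CauchyProduct R
  open LaurentSeries R
  open Paths R p a
  open Decompositions R p a
  open import Relation.Binary.Reasoning.Setoid setoid

  W-factor : ∀ i j → i < j → W p a j ≈L W p a i *L A p a (suc i) (j ∸ i ∸ 1)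
  W-factor i j i<j = ≋⇒≈L (≡.refl , coefficients)
    where
    open LastExit i (ℤ.+<+ i<j)
    Wᵢ = Laurent.cf (W p a i)
    Aᵢⱼ = Laurent.cf (A p a (suc i) (j ∸ i ∸ 1))

    j∸i∸1+suc-i≡j : ∀ i j → i < j → (j ∸ i ∸ 1) ℕ.+ suc i ≡ j
    j∸i∸1+suc-i≡j zero    (suc j) _         = ℕP.+-comm j 1
    j∸i∸1+suc-i≡j (suc i) (suc j) (s≤s i<j) = ≡.trans (ℕP.+-suc (j ∸ i ∸ 1) (suc i)) (cong suc (j∸i∸1+suc-i≡j i j i<j))

    Aᵢⱼ≈ascent : ∀ t → Aᵢⱼ t ≈ ascent t
    Aᵢⱼ≈ascent zero    = refl
    Aᵢⱼ≈ascent (suc m) = trans (Ac≈Above (suc i) m (j ∸ i ∸ 1))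
      (reflexive (cong (λ x → Above.pathSum (+ suc i) (+ suc i) m (+ x)) (j∸i∸1+suc-i≡j i j i<j)))

    coefficients : ∀ N → Laurent.cf (W p a j) N ≈ Laurent.cf (W p a i *L A p a (suc i) (j ∸ i ∸ 1)) N
    coefficients zero    = sym (trans (cf-*L (W p a i) (A p a (suc i) (j ∸ i ∸ 1)) 0) (zeroˡ _))
    coefficients (suc N) = begin
      Wc p a N j                                ≈⟨ Wc≈Free N j ⟩
      G (+ 0) N (+ j)                           ≈⟨ lastExit N (+ 0) ⟩
      U (+ 0) N + ((λ n → G (+ 0) n (+ i)) ⋆ ascent) N
        ≈⟨ +-cong (U-blocked N (ℤ.+≤+ z≤n)) (⋆-cong (λ n → sym (Wc≈Free n i)) (λ t → sym (Aᵢⱼ≈ascent t)) N) ⟩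
      0# + ((λ n → Wc p a n i) ⋆ Aᵢⱼ) N          ≈⟨ +-identityˡ _ ⟩
      ((λ n → Wc p a n i) ⋆ Aᵢⱼ) N               ≈⟨ shift-⋆ _ Aᵢⱼ N ⟨
      (shift (λ n → Wc p a n i) ⋆ Aᵢⱼ) (suc N)   ≈⟨ ⋆-cong {g = Aᵢⱼ} (λ t → sym (cf-series (λ n → Wc p a n i) t)) (λ _ → refl) (suc N) ⟩
      (Wᵢ ⋆ Aᵢⱼ) (suc N)                         ≈⟨ cf-*L (W p a i) (A p a (suc i) (j ∸ i ∸ 1)) (suc N) ⟨
      Laurent.cf (W p a i *L A p a (suc i) (j ∸ i ∸ 1)) (suc N) ∎

  c₀ : Carrier
  c₀ = a Fin.zero (+ 0)

  α β : ℕ → Seq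
  α g = Laurent.cf (Am1 p a 1 g)
  β k = Laurent.cf (Bm1 p a 1 k)

  w : Seq
  w n = Wc p a n 0

  D : Seq
  D t = ∑[ i ∈ allFin p ] ∑[ k ∈ upTo (suc (toℕ (Fin.suc i))) ]
          (a (Fin.suc i) (ℤ.- + k) * (α (toℕ (Fin.suc i) ∸ k) ⋆ β k) t)

  open FirstAscent using (arrival; firstAscent; arrival-0≈δ₀)
  open FirstDescent using (U₁; toZero; descentTerm; firstDescent; G≈firstDescent)

  α₀≈δ₀ : ∀ t → α 0 t ≈ δ₀ t
  α₀≈δ₀ zero    = refl
  α₀≈δ₀ (suc t) = refl

  ascent₁≈α : ∀ g → 1 ≤ g → ∀ t → shift (λ m → U₁ (+ 1) m (+ g)) t ≈ α g t
  ascent₁≈α (suc d) _ zero    = refl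
  ascent₁≈α (suc d) _ (suc m) =
    sym (trans (Ac≈Above 1 m d) (reflexive (cong (λ x → U₁ (+ 1) m (+ x)) (ℕP.+-comm d 1))))

  β≈arrival : ∀ k t → β k t ≈ arrival (ℤ.- + k) t
  β≈arrival zero    zero    = sym (G-zero-refl (+ 0))
  β≈arrival zero    (suc t) = sym (arrival-0≈δ₀ (suc t))
  β≈arrival (suc k) zero    = sym (G-zero-≢ {ℤ.- + suc k} {+ 0} (λ ()))
  β≈arrival (suc k) (suc n) =
    trans (Bc≈Below 1 n k) (reflexive (cong (λ h → Below.pathSum -[1+ 0 ] h n -[1+ 0 ]) (-k-1≡-[1+k] k)))
    where
    -k-1≡-[1+k] : ∀ k → ℤ.- + k ℤ.- + 1 ≡ -[1+ k ]
    -k-1≡-[1+k] zero    = ≡.refl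
    -k-1≡-[1+k] (suc k) = cong (λ m → -[1+ suc m ]) (ℕP.+-identityʳ k)

  toZero≈β⋆w : ∀ k m → toZero k m ≈ (β k ⋆ w) m
  toZero≈β⋆w k m = trans (firstAscent m (ℤ.- + k) ℤP.neg-≤-pos)
                         (⋆-cong (λ t → sym (β≈arrival k t)) (λ n → sym (Wc≈Free n 0)) m)

  jump : ℕ → Fin (suc p) → ℕ → Carrier
  jump M j k = a j (ℤ.- + k) * ((α (toℕ j ∸ k) ⋆ β k) ⋆ w) M

  descents≈jumps : ∀ M j → ∑ (upTo (toℕ j)) (descentTerm (+ 1) M j) ≈ ∑ (upTo (toℕ j)) (jump M j)
  descents≈jumps M j = begin
    ∑ (upTo (toℕ j)) (descentTerm (+ 1) M j)   ≡⟨ ∑-upTo (toℕ j) _ ⟩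
    ∑< (toℕ j) (descentTerm (+ 1) M j)
      ≈⟨ ∑<-cong (toℕ j) (λ k k<j → *-cong refl (trans
           (⋆-cong (ascent₁≈α _ (ℕP.m<n⇒0<n∸m k<j)) (toZero≈β⋆w k) M) (sym (⋆-assoc _ (β k) w M)))) ⟩
    ∑< (toℕ j) (jump M j)                      ≡⟨ ∑-upTo (toℕ j) _ ⟨
    ∑ (upTo (toℕ j)) (jump M j)                ∎

  direct≈jump : ∀ M j → a j (+ 0 ℤ.- + toℕ j) * G (+ 0 ℤ.- + toℕ j) M (+ 0) ≈ jump M j (toℕ j)
  direct≈jump M j = begin
    a j (+ 0 ℤ.- + toℕ j) * G (+ 0 ℤ.- + toℕ j) M (+ 0)
      ≡⟨ cong (λ h → a j h * G h M (+ 0)) (ℤP.+-identityˡ _) ⟩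
    a j (ℤ.- + toℕ j) * toZero (toℕ j) M
      ≈⟨ *-cong refl (toZero≈β⋆w (toℕ j) M) ⟩
    a j (ℤ.- + toℕ j) * (β (toℕ j) ⋆ w) M
      ≈⟨ *-cong refl (⋆-cong (λ t → trans (⋆-cong α₀≈δ₀ (λ _ → refl) t) (⋆-identityˡ (β (toℕ j)) t)) (λ _ → refl) M) ⟨
    a j (ℤ.- + toℕ j) * ((α 0 ⋆ β (toℕ j)) ⋆ w) M
      ≡⟨ cong (λ g → a j (ℤ.- + toℕ j) * ((α g ⋆ β (toℕ j)) ⋆ w) M) (ℕP.n∸n≡0 (toℕ j)) ⟨
    jump M j (toℕ j) ∎

  D⋆w : ∀ M → (D ⋆ w) M ≈ ∑[ i ∈ allFin p ] ∑ (upTo (suc (toℕ (Fin.suc i)))) (jump M (Fin.suc i))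
  D⋆w M = trans (⋆-∑ˡ (allFin p) _ w M) (∑-cong (allFin p) λ i →
            trans (⋆-∑ˡ (upTo (suc (toℕ (Fin.suc i)))) _ w M) (∑-cong (upTo (suc (toℕ (Fin.suc i)))) λ k → ⋆-*ˡ _ _ w M))

  w-suc : ∀ M → w (suc M) ≈ c₀ * w M + (D ⋆ w) M
  w-suc M = begin
    w (suc M)
      ≈⟨ trans (Wc≈Free (suc M) 0) (G-suc (+ 0) M (+ 0)) ⟩
    1# * G (+ 1) M (+ 0) + ∑ (allFin (suc p)) direct
      ≈⟨ +-cong (trans (*-identityˡ _) (G≈firstDescent M (+ 1) (ℤ.+<+ (s≤s z≤n)))) (reflexive (∑-allFin-suc p direct)) ⟩
    firstDescent (+ 1) M + (direct Fin.zero + ∑ (allFin p) (direct ∘ Fin.suc))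
      ≡⟨ cong (_+ (direct Fin.zero + ∑ (allFin p) (direct ∘ Fin.suc))) (∑-allFin-suc p descents) ⟩
    (0# + ∑ (allFin p) (descents ∘ Fin.suc)) + (direct Fin.zero + ∑ (allFin p) (direct ∘ Fin.suc))
      ≈⟨ +-cong (+-identityˡ _) (+-cong (*-cong refl (sym (Wc≈Free M 0))) refl) ⟩
    ∑ (allFin p) (descents ∘ Fin.suc) + (c₀ * w M + ∑ (allFin p) (direct ∘ Fin.suc))
      ≈⟨ x∙yz≈y∙xz _ _ _ ⟩
    c₀ * w M + (∑ (allFin p) (descents ∘ Fin.suc) + ∑ (allFin p) (direct ∘ Fin.suc))
      ≈⟨ +-cong refl (sym (∑-distrib-+ (allFin p) _ _)) ⟩
    c₀ * w M + ∑[ i ∈ allFin p ] (descents (Fin.suc i) + direct (Fin.suc i))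
      ≈⟨ +-cong refl (∑-cong (allFin p) λ i → trans (+-cong (descents≈jumps M (Fin.suc i)) (direct≈jump M (Fin.suc i)))
                                                    (sym (∑-upTo-suc (toℕ (Fin.suc i)) (jump M (Fin.suc i))))) ⟩
    c₀ * w M + ∑[ i ∈ allFin p ] ∑ (upTo (suc (toℕ (Fin.suc i)))) (jump M (Fin.suc i))
      ≈⟨ +-cong refl (D⋆w M) ⟨
    c₀ * w M + (D ⋆ w) M ∎
    where
    open CommutativeSemigroupProperties +-commutativeSemigroup using (x∙yz≈y∙xz)
    descents direct : Fin (suc p) → Carrier
    descents j = ∑ (upTo (toℕ j)) (descentTerm (+ 1) M j)
    direct   j = a j (+ 0 ℤ.- + toℕ j) * G (+ 0 ℤ.- + toℕ j) M (+ 0)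

  denominator : Laurent
  denominator = zL -L constL c₀ -L ⟨ 0 , D ⟩

  denom≋denominator : denom p a ≋ denominator
  denom≋denominator = +L-cong (≋-refl {zL -L constL c₀}) (-L-cong
    (sumL-≋ (allFin p) _ _ λ i → sumL-≋ (upTo (suc (toℕ (Fin.suc i)))) _ _ λ k →
      product≋ (a (Fin.suc i) (ℤ.- + k)) (toℕ (Fin.suc i) ∸ k) k))
    where
    Am1≋ : ∀ g → Am1 p a 1 g ≋ ⟨ 0 , α g ⟩
    Am1≋ zero    = ≋-refl
    Am1≋ (suc g) = ≋-refl
    Bm1≋ : ∀ k → Bm1 p a 1 k ≋ ⟨ 0 , β k ⟩
    Bm1≋ zero    = ≋-refl
    Bm1≋ (suc k) = ≋-refl
    product≋ : ∀ x g k → constL x *L Am1 p a 1 g *L Bm1 p a 1 k ≋ ⟨ 0 , (λ t → x * (α g ⋆ β k) t) ⟩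
    product≋ x g k = ≋-trans (*L-cong (*L-cong (≋-refl {constL x}) (Am1≋ g)) (Bm1≋ k)) (≡.refl , λ t →
      trans (cf-*L (constL x *L ⟨ 0 , α g ⟩) ⟨ 0 , β k ⟩ t)
            (trans (⋆-cong (λ s → trans (cf-*L (constL x) ⟨ 0 , α g ⟩ s) (constL-⋆ x (α g) s)) (λ _ → refl) t) (⋆-*ˡ x (α g) (β k) t)))

  denominator⋆w : ∀ n → (Laurent.cf denominator ⋆ w) n ≈ δ₀ n
  denominator⋆w zero    = trans (*-cong (trans (+-identityʳ _) (+-identityʳ _)) (trans (Wc≈Free 0 0) (G-zero-refl (+ 0))))
                                (*-identityˡ _)
  denominator⋆w (suc M) = begin
    d 0 * w (suc M) + ((d ∘ suc) ⋆ w) M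
      ≈⟨ +-cong (*-cong (trans (+-identityʳ _) (+-identityʳ _)) refl) (⋆-cong (λ t → +-cong (+-identityˡ _) refl) (λ _ → refl) M) ⟩
    1# * w (suc M) + ((λ t → - Laurent.cf (constL c₀) t + - D t) ⋆ w) M
      ≈⟨ +-cong (*-identityˡ _) (trans (⋆-distribʳ-+ _ _ w M) (+-cong (⋆-negˡ _ w M) (⋆-negˡ D w M))) ⟩
    w (suc M) + (- (Laurent.cf (constL c₀) ⋆ w) M + - (D ⋆ w) M)
      ≈⟨ +-cong (w-suc M) (trans (⁻¹-∙-comm _ _) (-‿cong (+-cong (constL-⋆ c₀ w M) refl))) ⟩
    (c₀ * w M + (D ⋆ w) M) + - (c₀ * w M + (D ⋆ w) M)
      ≈⟨ -‿inverseʳ _ ⟩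
    0# ∎
    where
    d = Laurent.cf denominator
    open AbelianGroupProperties +-abelianGroup using (⁻¹-∙-comm)

  W₀*denom≈1 : W p a 0 *L denom p a ≈L 1L
  W₀*denom≈1 e = trans (≋⇒≈L (*L-cong (≋-refl {W p a 0}) denom≋denominator) e) (⟨1,shift-δ₀⟩≈1L coefficients e)
    where
    coefficients : ∀ n → Laurent.cf (W p a 0 *L denominator) n ≈ shift δ₀ n
    coefficients zero    = trans (cf-*L (W p a 0) denominator 0) (zeroˡ _)
    coefficients (suc n) = begin
      Laurent.cf (W p a 0 *L denominator) (suc n)   ≈⟨ cf-*L (W p a 0) denominator (suc n) ⟩
      (Laurent.cf (W p a 0) ⋆ Laurent.cf denominator) (suc n)
        ≈⟨ ⋆-cong (cf-series (λ m → Wc p a m 0)) (λ _ → refl) (suc n) ⟩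
      (shift w ⋆ Laurent.cf denominator) (suc n)     ≈⟨ shift-⋆ w _ n ⟩
      (w ⋆ Laurent.cf denominator) n                 ≈⟨ ⋆-comm w _ n ⟩
      (Laurent.cf denominator ⋆ w) n                 ≈⟨ denominator⋆w n ⟩
      δ₀ n ∎

theorem1p4 : ∀ {c ℓ} (R : CommutativeRing c ℓ) (p : ℕ) → 1 ≤ p →
    (a : Fin (suc p) → ℤ → CommutativeRing.Carrier R) →
    let open Setup R in
      (W p a 0 *L denom p a ≈L 1L)
      × (∀ (j : ℕ) → 1 ≤ j → j ≤ p → W p a j ≈L W p a 0 *L A p a 1 (j ∸ 1))
      × (∀ (i j : ℕ) → i < j → j ≤ p → W p a j ≈L W p a i *L A p a (suc i) (j ∸ i ∸ 1))
theorem1p4 R p _ a = W₀*denom≈1 , (λ j 0<j _ → W-factor 0 j 0<j) , (λ i j i<j _ → W-factor i j i<j)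
  where open Identities R p a
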